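{- Let $i\ge 3$ be an integer and let $a\in\{2^i,2^i-1\}$. Then $\mathrm{b}(a,2)=i+2$.
   Context: $\mathrm{b}(a,b)$ denotes the base size (smallest cardinality of a subset whose pointwise stabilizer is trivial) of $\mathrm{Sym}(ab)$ acting on the set of partitions of $\{1,\ldots,ab\}$ into $b$ parts each of cardinality $a$. -}

module Defs where

open import Data.Nat using (ℕ; _*_; _≤_)
open import Data.Fin using (Fin; _≟_)
open import Data.Fin.Permutation using (Permutation′; _⟨$⟩ʳ_)
open import Data.List using (List; length; filter; allFin)
open import Data.Product using (Σ; _×_; ∃)
open import Relation.Binary.PropositionalEquality using (_≡_)
open import Function.Bundles using (_⇔_)

-- A partition of {0,…,ab-1} into b parts, each of cardinality a, is
-- represented by a labelling  f : Fin (a * b) → Fin b  whose every fibre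
-- has exactly a elements; the partition is {f⁻¹(j) | j : Fin b}.
-- (Relabelling the parts gives the same partition; all notions below only
-- depend on the underlying partition, i.e. on the relation f x ≡ f y.)
Labelling : ℕ → ℕ → Set
Labelling a b = Fin (a * b) → Fin b

IsEquipartition : (a b : ℕ) → Labelling a b → Set
IsEquipartition a b f =
  (j : Fin b) → length (filter (λ x → f x ≟ j) (allFin (a * b))) ≡ a

Partition : ℕ → ℕ → Set
Partition a b = Σ (Labelling a b) (IsEquipartition a b)

Fixes : {a b : ℕ} → Permutation′ (a * b) → Partition a b → Set
Fixes σ (f Data.Product., _) =
  ∀ x y → (f x ≡ f y) ⇔ (f (σ ⟨$⟩ʳ x) ≡ f (σ ⟨$⟩ʳ y))

data All {a b : ℕ} (σ : Permutation′ (a * b)) : List (Partition a b) → Set where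
  []  : All σ List.[]
  _∷_ : ∀ {P Ps} → Fixes σ P → All σ Ps → All σ (P List.∷ Ps)

IsBase : (a b : ℕ) → List (Partition a b) → Set
IsBase a b Ps =
  (σ : Permutation′ (a * b)) → All σ Ps → ∀ x → σ ⟨$⟩ʳ x ≡ x

BaseSizeIs : (a b k : ℕ) → Set
BaseSizeIs a b k =
  (∃ λ (Ps : List (Partition a b)) → IsBase a b Ps × length Ps ≡ k)
  × ((Ps : List (Partition a b)) → IsBase a b Ps → k ≤ length Ps)

module Submission where

-- Label each of the 2a points by the vector in {0,1}^k recording which part
-- it occupies in each of k bisections.  If the bisections form a base this
-- labelling is injective (otherwise a transposition fixes them all), so
-- 2a ≤ 2^k and k ≥ i + 1.  If k = i + 1, every half-cube {v | v_j = β}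
-- contains exactly a labels, i.e. misses 2^i − a ≤ 1 vectors; hence the
-- missing vectors, and so the labels, are closed under complementation,
-- and exchanging each point with the point of complementary label fixes
-- every bisection.  So k ≥ i + 2.
--
-- Conversely, view the points as pairs (row q, column b), give row q an
-- address in {0,1}^i so that exactly one vector (the hole) is unaddressed,
-- and take the bisection by b, the i bisections by (bit j of the address)
-- ⊕ b, and one bisection by a colouring that separates rows sharing an
-- address (there is one such pair when a = 2^i).  A permutation fixing
-- these acts on addresses by a translation, which must fix the hole and so
-- is trivial, and the colouring rules out exchanging the columns.

open import Defs
open import Data.Nat using (ℕ; _+_; _∸_; _^_; _≤_)
open import Data.Sum using (_⊎_)
open import Relation.Binary.PropositionalEquality using (_≡_)

open import Data.Nat using (zero; suc; _*_; _<_; z≤n; s≤s; _<?_)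
open import Data.Nat.Properties
  using ( +-identityʳ; +-assoc; +-comm; +-mono-≤; +-cancelˡ-≤; +-cancelˡ-≡; *-identityˡ; *-identityʳ
        ; *-zeroʳ; *-comm; *-distribˡ-+; m+[n∸m]≡n; m∸n≤m; ≤-refl; ≤-reflexive; ≤-trans; ≤-pred; m≤m+n
        ; m≤n+m; n≤1+n; n≤0⇒n≡0; n≤1⇒n≡0∨n≡1; <⇒≢; ≤∧≢⇒<; ≮⇒≥; ^-monoʳ-≤; module ≤-Reasoning
        ; +-commutativeSemigroup; +-*-semiring )
open import Data.Fin using (Fin; zero; suc; _≟_; quotient; remainder; combine; finToFun; funToFin)
open import Data.Fin.Patterns using (0F; 1F; 2F; 3F; 4F)
import Data.Fin.Properties as Finₚ
open import Data.Fin.Permutation using (Permutation′; _⟨$⟩ʳ_; permutation; transpose)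
import Data.Fin.Permutation.Components as PC
open import Data.List as List using (List; []; _∷_; length; filter; tabulate)
open import Data.List.Properties using (length-tabulate)
open import Data.Vec as Vec using (Vec; []; _∷_; lookup)
open import Data.Vec.Properties
  using (≡-dec; ∷-injective; ∷-injectiveˡ; map-id; tabulate∘lookup; tabulate-cong; lookup∘tabulate)
open import Data.Product using (∃; _,_; proj₁; proj₂)
open import Data.Sum using (inj₁; inj₂; [_,_]′; map₂)
open import Function using (_∘_; id)
open import Function.Bundles using (_⇔_; mk⇔; module Equivalence; _↔_; mk↔ₛ′; module Inverse; module Injection)
open import Function.Properties.Inverse using (↔⇒↣)
open import Relation.Binary.Definitions using (DecidableEquality)
open import Relation.Binary.PropositionalEquality
  using (_≢_; ≢-sym; refl; sym; trans; cong; cong₂; subst; module ≡-Reasoning)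
open import Relation.Nullary using (Dec; yes; no; ¬_; contradiction)
open import Algebra.Properties.CommutativeSemigroup +-commutativeSemigroup
  using () renaming (interchange to +-interchange)
open import Algebra.Properties.Semiring.Sum +-*-semiring
  using (sum; sum-syntax; sum-cong-≗; sum-replicate-zero)

not : Fin 2 → Fin 2
not 0F = 1F
not 1F = 0F

_⊕_ : Fin 2 → Fin 2 → Fin 2
0F ⊕ b = b
1F ⊕ b = not b

infixl 6 _⊕_

not-involutive : ∀ b → not (not b) ≡ b
not-involutive 0F = refl
not-involutive 1F = refl

not-injective : ∀ {b c} → not b ≡ not c → b ≡ c
not-injective {b} {c} eq =
  trans (sym (not-involutive b)) (trans (cong not eq) (not-involutive c))

b≢not-b : ∀ b → b ≢ not b
b≢not-b 0F ()
b≢not-b 1F ()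

≢⇒≡not : ∀ {b c} → b ≢ c → c ≡ not b
≢⇒≡not {0F} {0F} b≢c = contradiction refl b≢c
≢⇒≡not {0F} {1F} _   = refl
≢⇒≡not {1F} {0F} _   = refl
≢⇒≡not {1F} {1F} b≢c = contradiction refl b≢c

⊕-self : ∀ b → b ⊕ b ≡ 0F
⊕-self 0F = refl
⊕-self 1F = refl

⊕≡0⇒≡ : ∀ {b c} → b ⊕ c ≡ 0F → b ≡ c
⊕≡0⇒≡ {0F} {0F} _ = refl
⊕≡0⇒≡ {1F} {1F} _ = refl

not-⊕-not : ∀ b c → not b ⊕ not c ≡ b ⊕ c
not-⊕-not 0F c = not-involutive c
not-⊕-not 1F c = refl

⊕-interchange : ∀ b c d e → (b ⊕ c) ⊕ (d ⊕ e) ≡ (b ⊕ d) ⊕ (c ⊕ e)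
⊕-interchange 0F 0F d e = refl
⊕-interchange 0F 1F 0F e = refl
⊕-interchange 0F 1F 1F e = refl
⊕-interchange 1F 0F 0F e = refl
⊕-interchange 1F 0F 1F e = not-involutive e
⊕-interchange 1F 1F 0F e = sym (not-involutive e)
⊕-interchange 1F 1F 1F e = refl

⊕-moveʳ : ∀ {b c d} → b ⊕ c ≡ d → b ≡ d ⊕ c
⊕-moveʳ {0F} {0F} refl = refl
⊕-moveʳ {0F} {1F} refl = refl
⊕-moveʳ {1F} {0F} refl = refl
⊕-moveʳ {1F} {1F} refl = refl

⊕-moveˡ : ∀ {b c d} → b ⊕ c ≡ d → c ≡ b ⊕ d
⊕-moveˡ {0F} refl = refl
⊕-moveˡ {1F} refl = sym (not-involutive _)

⊕-cancelˡ : ∀ {b c d} → (b ⊕ c) ⊕ d ≡ b → d ≡ c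
⊕-cancelˡ {0F} {0F} {0F} _  = refl
⊕-cancelˡ {0F} {0F} {1F} ()
⊕-cancelˡ {0F} {1F} {0F} ()
⊕-cancelˡ {0F} {1F} {1F} _  = refl
⊕-cancelˡ {1F} {0F} {0F} _  = refl
⊕-cancelˡ {1F} {0F} {1F} ()
⊕-cancelˡ {1F} {1F} {0F} ()
⊕-cancelˡ {1F} {1F} {1F} _  = refl

b⊕c≡c⇒b≡0 : ∀ {b c} → b ⊕ c ≡ c → b ≡ 0F
b⊕c≡c⇒b≡0 {0F} _ = refl
b⊕c≡c⇒b≡0 {1F} {0F} ()
b⊕c≡c⇒b≡0 {1F} {1F} ()

⊕-distinct : ∀ b → b ⊕ 0F ≢ b ⊕ 1F
⊕-distinct 0F ()
⊕-distinct 1F ()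

-- Read with b = f x, c = f y, d = f (σ x), e = f (σ y): a permutation σ
-- fixing the bisection f shifts its labels by the constant f x ⊕ f (σ x).
≡⇔≡⇒⊕≡⊕ : ∀ {b c d e} → (b ≡ c) ⇔ (d ≡ e) → b ⊕ d ≡ c ⊕ e
≡⇔≡⇒⊕≡⊕ {b} {c} {d} {e} b≡c⇔d≡e with b ≟ c
... | yes refl = cong (b ⊕_) (Equivalence.to b≡c⇔d≡e refl)
... | no b≢c = begin
  b ⊕ d             ≡⟨ not-⊕-not b d ⟨
  not b ⊕ not d     ≡⟨ cong₂ _⊕_ (≢⇒≡not b≢c) (≢⇒≡not (b≢c ∘ Equivalence.from b≡c⇔d≡e)) ⟨
  c ⊕ e             ∎
  where open ≡-Reasoning

𝟙 : ∀ {p} {P : Set p} → Dec P → ℕ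
𝟙 (yes _) = 1
𝟙 (no _)  = 0

module _ {p} {P : Set p} where

  𝟙-yes : (d : Dec P) → P → 𝟙 d ≡ 1
  𝟙-yes (yes _) _ = refl
  𝟙-yes (no ¬p) p = contradiction p ¬p

  𝟙-no : (d : Dec P) → ¬ P → 𝟙 d ≡ 0
  𝟙-no (yes p) ¬p = contradiction p ¬p
  𝟙-no (no _)  _  = refl

𝟙-complementary : ∀ b β → 𝟙 (b ≟ β) + 𝟙 (not b ≟ β) ≡ 1
𝟙-complementary 0F 0F = refl
𝟙-complementary 0F 1F = refl
𝟙-complementary 1F 0F = refl
𝟙-complementary 1F 1F = refl

sum-ones : ∀ n → ∑[ _ < n ] 1 ≡ n
sum-ones zero    = refl
sum-ones (suc n) = cong suc (sum-ones n)

sum-zero : ∀ {n} (f : Fin n → ℕ) → (∀ i → f i ≡ 0) → sum f ≡ 0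
sum-zero {n} f f≡0 = trans (sum-cong-≗ f≡0) (sum-replicate-zero n)

sum-only : ∀ {n} (f : Fin n → ℕ) i → (∀ j → j ≢ i → f j ≡ 0) → sum f ≡ f i
sum-only {suc n} f zero    vanish =
  trans (cong (f zero +_) (sum-zero (f ∘ suc) (λ j → vanish (suc j) λ ()))) (+-identityʳ _)
sum-only {suc n} f (suc i) vanish =
  cong₂ _+_ (vanish zero λ ()) (sum-only (f ∘ suc) i λ j j≢i → vanish (suc j) (j≢i ∘ Finₚ.suc-injective))

length-filter-tabulate : ∀ {p} {A : Set} {P : A → Set p} (P? : ∀ x → Dec (P x)) {n} (g : Fin n → A) →
                         length (filter P? (tabulate g)) ≡ ∑[ x < n ] 𝟙 (P? (g x))
length-filter-tabulate P? {zero}  g = refl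
length-filter-tabulate P? {suc n} g with P? (g zero)
... | yes _ = cong suc (length-filter-tabulate P? (g ∘ suc))
... | no _  = length-filter-tabulate P? (g ∘ suc)

-- Sums over the cube of bit vectors

Bits : ℕ → Set
Bits = Vec (Fin 2)

_≟ᵇ_ : ∀ {k} → DecidableEquality (Bits k)
_≟ᵇ_ = ≡-dec _≟_

lookup-extensionality : ∀ {k} {u v : Bits k} → (∀ j → lookup u j ≡ lookup v j) → u ≡ v
lookup-extensionality {u = u} {v} u≗v = trans (sym (tabulate∘lookup u)) (trans (tabulate-cong u≗v) (tabulate∘lookup v))

complement : ∀ {k} → Bits k → Bits k
complement = Vec.map not

complement-involutive : ∀ {k} (v : Bits k) → complement (complement v) ≡ v
complement-involutive []      = refl
complement-involutive (b ∷ v) = cong₂ _∷_ (not-involutive b) (complement-involutive v)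

≢complement⇒agree : ∀ {k} {u v : Bits k} → v ≢ complement u → ∃ λ j → lookup v j ≡ lookup u j
≢complement⇒agree {u = []}    {[]}    v≢u̅ = contradiction refl v≢u̅
≢complement⇒agree {u = b ∷ u} {c ∷ v} v≢u̅ with c ≟ b
... | yes c≡b = zero , c≡b
... | no  c≢b = let j , vⱼ≡uⱼ = ≢complement⇒agree (v≢u̅ ∘ cong₂ _∷_ (≢⇒≡not (c≢b ∘ sym)))
                in suc j , vⱼ≡uⱼ

∑Bits : ∀ k → (Bits k → ℕ) → ℕ
∑Bits zero    h = h []
∑Bits (suc k) h = ∑Bits k (h ∘ (0F ∷_)) + ∑Bits k (h ∘ (1F ∷_))

∑Bits-cong : ∀ k {h h′ : Bits k → ℕ} → (∀ v → h v ≡ h′ v) → ∑Bits k h ≡ ∑Bits k h′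
∑Bits-cong zero    h≗h′ = h≗h′ []
∑Bits-cong (suc k) h≗h′ = cong₂ _+_ (∑Bits-cong k (h≗h′ ∘ (0F ∷_))) (∑Bits-cong k (h≗h′ ∘ (1F ∷_)))

∑Bits-mono : ∀ k {h h′ : Bits k → ℕ} → (∀ v → h v ≤ h′ v) → ∑Bits k h ≤ ∑Bits k h′
∑Bits-mono zero    h≤h′ = h≤h′ []
∑Bits-mono (suc k) h≤h′ = +-mono-≤ (∑Bits-mono k (h≤h′ ∘ (0F ∷_))) (∑Bits-mono k (h≤h′ ∘ (1F ∷_)))

∑Bits-distrib-+ : ∀ k (h h′ : Bits k → ℕ) → ∑Bits k (λ v → h v + h′ v) ≡ ∑Bits k h + ∑Bits k h′
∑Bits-distrib-+ zero    h h′ = refl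
∑Bits-distrib-+ (suc k) h h′ = begin
  ∑Bits k (λ v → h (0F ∷ v) + h′ (0F ∷ v)) + ∑Bits k (λ v → h (1F ∷ v) + h′ (1F ∷ v))
    ≡⟨ cong₂ _+_ (∑Bits-distrib-+ k _ _) (∑Bits-distrib-+ k _ _) ⟩
  (h₀ + h′₀) + (h₁ + h′₁)
    ≡⟨ +-interchange h₀ h′₀ h₁ h′₁ ⟩
  (h₀ + h₁) + (h′₀ + h′₁) ∎
  where
  open ≡-Reasoning
  h₀ = ∑Bits k (h ∘ (0F ∷_))
  h₁ = ∑Bits k (h ∘ (1F ∷_))
  h′₀ = ∑Bits k (h′ ∘ (0F ∷_))
  h′₁ = ∑Bits k (h′ ∘ (1F ∷_))

∑Bits-zero : ∀ k (h : Bits k → ℕ) → (∀ v → h v ≡ 0) → ∑Bits k h ≡ 0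
∑Bits-zero zero    h h≡0 = h≡0 []
∑Bits-zero (suc k) h h≡0 = cong₂ _+_ (∑Bits-zero k _ (h≡0 ∘ (0F ∷_))) (∑Bits-zero k _ (h≡0 ∘ (1F ∷_)))

∑Bits-only : ∀ k (h : Bits k → ℕ) w → (∀ v → v ≢ w → h v ≡ 0) → ∑Bits k h ≡ h w
∑Bits-only zero    h [] vanish = refl
∑Bits-only (suc k) h (0F ∷ w) vanish = begin
  ∑Bits k (h ∘ (0F ∷_)) + ∑Bits k (h ∘ (1F ∷_))
    ≡⟨ cong₂ _+_ (∑Bits-only k _ w λ v v≢w → vanish (0F ∷ v) (v≢w ∘ proj₂ ∘ ∷-injective))
                 (∑Bits-zero k _ λ v → vanish (1F ∷ v) λ ()) ⟩
  h (0F ∷ w) + 0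
    ≡⟨ +-identityʳ _ ⟩
  h (0F ∷ w) ∎
  where open ≡-Reasoning
∑Bits-only (suc k) h (1F ∷ w) vanish =
  cong₂ _+_ (∑Bits-zero k _ λ v → vanish (0F ∷ v) λ ())
            (∑Bits-only k _ w λ v v≢w → vanish (1F ∷ v) (v≢w ∘ proj₂ ∘ ∷-injective))

∑Bits-≥ : ∀ k (h : Bits k → ℕ) u → h u ≤ ∑Bits k h
∑Bits-≥ zero    h []       = ≤-refl
∑Bits-≥ (suc k) h (0F ∷ u) = ≤-trans (∑Bits-≥ k (h ∘ (0F ∷_)) u) (m≤m+n _ _)
∑Bits-≥ (suc k) h (1F ∷ u) = ≤-trans (∑Bits-≥ k (h ∘ (1F ∷_)) u) (m≤n+m _ _)

∑Bits-≥-pair : ∀ k (h : Bits k → ℕ) {u v} → u ≢ v → h u + h v ≤ ∑Bits k h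
∑Bits-≥-pair zero    h {[]} {[]} u≢v = contradiction refl u≢v
∑Bits-≥-pair (suc k) h {0F ∷ u} {0F ∷ v} u≢v =
  ≤-trans (∑Bits-≥-pair k (h ∘ (0F ∷_)) (u≢v ∘ cong (0F ∷_))) (m≤m+n _ _)
∑Bits-≥-pair (suc k) h {0F ∷ u} {1F ∷ v} _ =
  +-mono-≤ (∑Bits-≥ k (h ∘ (0F ∷_)) u) (∑Bits-≥ k (h ∘ (1F ∷_)) v)
∑Bits-≥-pair (suc k) h {1F ∷ u} {0F ∷ v} _ =
  ≤-trans (≤-reflexive (+-comm (h (1F ∷ u)) _)) (+-mono-≤ (∑Bits-≥ k (h ∘ (0F ∷_)) v) (∑Bits-≥ k (h ∘ (1F ∷_)) u))
∑Bits-≥-pair (suc k) h {1F ∷ u} {1F ∷ v} u≢v =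
  ≤-trans (∑Bits-≥-pair k (h ∘ (1F ∷_)) (u≢v ∘ cong (1F ∷_))) (m≤n+m _ _)

∑Bits-ones : ∀ k → ∑Bits k (λ _ → 1) ≡ 2 ^ k
∑Bits-ones zero    = refl
∑Bits-ones (suc k) = cong₂ _+_ (∑Bits-ones k) (trans (∑Bits-ones k) (sym (+-identityʳ _)))

∑Bits-coordinate : ∀ k j β → ∑Bits (suc k) (λ v → 𝟙 (lookup v j ≟ β)) ≡ 2 ^ k
∑Bits-coordinate k zero 0F =
  trans (cong₂ _+_ (∑Bits-ones k) (∑Bits-zero k _ λ _ → refl)) (+-identityʳ _)
∑Bits-coordinate k zero 1F = cong₂ _+_ (∑Bits-zero k _ λ _ → refl) (∑Bits-ones k)
∑Bits-coordinate (suc k) (suc j) β =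
  cong₂ _+_ (∑Bits-coordinate k j β) (trans (∑Bits-coordinate k j β) (sym (+-identityʳ _)))

halfSum : ∀ {k} → Fin k → Fin 2 → (Bits k → ℕ) → ℕ
halfSum {k} j β h = ∑Bits k (λ v → 𝟙 (lookup v j ≟ β) * h v)

halfSum-≥ : ∀ {k} (h : Bits k → ℕ) j v → h v ≤ halfSum j (lookup v j) h
halfSum-≥ {k} h j v =
  subst (_≤ halfSum j (lookup v j) h)
        (trans (cong (_* h v) (𝟙-yes (lookup v j ≟ lookup v j) refl)) (*-identityˡ (h v)))
        (∑Bits-≥ k (λ w → 𝟙 (lookup w j ≟ lookup v j) * h w) v)

halfSum-+-1∸ : ∀ {k} (h : Bits (suc k) → ℕ) → (∀ v → h v ≤ 1) →
                     ∀ j β → halfSum j β h + halfSum j β (λ v → 1 ∸ h v) ≡ 2 ^ k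
halfSum-+-1∸ {k} h h≤1 j β = begin
  halfSum j β h + halfSum j β (λ v → 1 ∸ h v)
    ≡⟨ ∑Bits-distrib-+ (suc k) (λ v → 𝟙 (lookup v j ≟ β) * h v) (λ v → 𝟙 (lookup v j ≟ β) * (1 ∸ h v)) ⟨
  ∑Bits (suc k) (λ v → 𝟙 (lookup v j ≟ β) * h v + 𝟙 (lookup v j ≟ β) * (1 ∸ h v))
    ≡⟨ ∑Bits-cong (suc k) (λ v → begin
         𝟙 (lookup v j ≟ β) * h v + 𝟙 (lookup v j ≟ β) * (1 ∸ h v)
           ≡⟨ *-distribˡ-+ (𝟙 (lookup v j ≟ β)) (h v) (1 ∸ h v) ⟨
         𝟙 (lookup v j ≟ β) * (h v + (1 ∸ h v))
           ≡⟨ cong (𝟙 (lookup v j ≟ β) *_) (m+[n∸m]≡n (h≤1 v)) ⟩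
         𝟙 (lookup v j ≟ β) * 1
           ≡⟨ *-identityʳ _ ⟩
         𝟙 (lookup v j ≟ β) ∎) ⟩
  ∑Bits (suc k) (λ v → 𝟙 (lookup v j ≟ β))
    ≡⟨ ∑Bits-coordinate k j β ⟩
  2 ^ k ∎
  where open ≡-Reasoning

-- If every half of the cube carries total weight 1, a weight-1 point forces
-- its half to be empty elsewhere; a point agreeing with u somewhere lies in
-- a common half with u.
halves-one⇒vanishes : ∀ {k} (h : Bits (suc k) → ℕ) → (∀ j β → halfSum j β h ≡ 1) →
                      ∀ {u} → h u ≡ 1 → ∀ {v} → v ≢ u → v ≢ complement u → h v ≡ 0
halves-one⇒vanishes {k} h halves {u} hu≡1 {v} v≢u v≢ū = n≤0⇒n≡0 (+-cancelˡ-≤ 1 (h v) 0 1+hv≤1)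
  where
  j = proj₁ (≢complement⇒agree v≢ū)
  β = lookup u j
  weighted : Bits (suc k) → ℕ
  weighted w = 𝟙 (lookup w j ≟ β) * h w
  weighted-at : ∀ w → lookup w j ≡ β → weighted w ≡ h w
  weighted-at w wⱼ≡β = trans (cong (_* h w) (𝟙-yes (lookup w j ≟ β) wⱼ≡β)) (*-identityˡ (h w))
  1+hv≤1 : 1 + h v ≤ 1 + 0
  1+hv≤1 = begin
    1 + h v                   ≡⟨ cong₂ _+_ (trans (sym hu≡1) (sym (weighted-at u refl)))
                                            (sym (weighted-at v (proj₂ (≢complement⇒agree v≢ū)))) ⟩
    weighted u + weighted v   ≤⟨ ∑Bits-≥-pair (suc k) weighted (v≢u ∘ sym) ⟩
    halfSum j β h             ≡⟨ halves j β ⟩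
    1                         ∎
    where open ≤-Reasoning

halves-one⇒complement : ∀ {k} (h : Bits (suc k) → ℕ) → (∀ j β → halfSum j β h ≡ 1) →
                        ∀ {u} → h u ≡ 1 → h (complement u) ≡ 1
halves-one⇒complement {k} h halves {b ∷ u} hu≡1 = begin
  h ū                                ≡⟨ *-identityˡ (h ū) ⟨
  1 * h ū                            ≡⟨ cong (_* h ū) (𝟙-yes (not b ≟ not b) refl) ⟨
  𝟙 (not b ≟ not b) * h ū            ≡⟨ ∑Bits-only (suc k) weighted ū vanish ⟨
  halfSum zero (not b) h             ≡⟨ halves zero (not b) ⟩
  1                                  ∎
  where
  open ≡-Reasoning
  ū = complement (b ∷ u)
  weighted : Bits (suc k) → ℕ
  weighted w = 𝟙 (lookup w zero ≟ not b) * h w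
  vanish : ∀ v → v ≢ ū → weighted v ≡ 0
  vanish v v≢ū with v ≟ᵇ (b ∷ u)
  ... | yes refl = cong (_* h v) (𝟙-no (b ≟ not b) (b≢not-b b))
  ... | no  v≢u  = trans (cong (𝟙 (lookup v zero ≟ not b) *_) (halves-one⇒vanishes h halves hu≡1 v≢u v≢ū))
                         (*-zeroʳ (𝟙 (lookup v zero ≟ not b)))

complement-closed : ∀ {k a} (In : Bits (suc k) → ℕ) → (∀ v → In v ≤ 1) →
                    (∀ j β → halfSum j β In ≡ a) → a ≡ 2 ^ k ⊎ suc a ≡ 2 ^ k →
                    ∀ {w} → In w ≡ 1 → In (complement w) ≡ 1
complement-closed {k} {a} In In≤1 halves a-cases {w} Inw≡1 = begin
  In w̄               ≡⟨ +-identityʳ (In w̄) ⟨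
  In w̄ + 0           ≡⟨ cong (In w̄ +_) (missing-w̄ a-cases) ⟨
  In w̄ + miss w̄      ≡⟨ m+[n∸m]≡n (In≤1 w̄) ⟩
  1                  ∎
  where
  open ≡-Reasoning
  w̄ = complement w
  miss : Bits (suc k) → ℕ
  miss v = 1 ∸ In v
  missing-halves : ∀ j β → a + halfSum j β miss ≡ 2 ^ k
  missing-halves j β = trans (cong (_+ halfSum j β miss) (sym (halves j β))) (halfSum-+-1∸ In In≤1 j β)
  missing-w̄ : a ≡ 2 ^ k ⊎ suc a ≡ 2 ^ k → miss w̄ ≡ 0
  missing-w̄ (inj₁ a≡2ᵏ) = n≤0⇒n≡0 (≤-trans (halfSum-≥ miss zero w̄) (≤-reflexive
          (+-cancelˡ-≡ a _ 0 (trans (missing-halves zero (lookup w̄ zero)) (trans (sym a≡2ᵏ) (sym (+-identityʳ a)))))))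
  missing-w̄ (inj₂ 1+a≡2ᵏ) with n≤1⇒n≡0∨n≡1 (m∸n≤m 1 (In w̄))
  ...   | inj₁ miss-w̄≡0 = miss-w̄≡0
  ...   | inj₂ miss-w̄≡1 = contradiction (trans (sym miss-w≡1) (cong (1 ∸_) Inw≡1)) λ ()
    where
    miss-w≡1 : miss w ≡ 1
    miss-w≡1 = subst (λ v → miss v ≡ 1) (complement-involutive w)
      (halves-one⇒complement miss (λ j β → +-cancelˡ-≡ a _ 1 (trans (missing-halves j β) (trans (sym 1+a≡2ᵏ) (+-comm 1 a))))
                             miss-w̄≡1)

-- The lower bound

transpose-respects : ∀ {n} {A : Set} (f : Fin n → A) {x y} → f x ≡ f y → ∀ z → f (PC.transpose x y z) ≡ f z
transpose-respects f {x} {y} fx≡fy z with z ≟ x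
... | yes refl = sym fx≡fy
... | no _ with z ≟ y
...   | yes refl = fx≡fy
...   | no _     = refl

transpose-left : ∀ {n} (x y : Fin n) → PC.transpose x y x ≡ y
transpose-left x y with x ≟ x
... | yes _   = refl
... | no  x≢x = contradiction refl x≢x

labels : ∀ {a b} (Ps : List (Partition a b)) → Fin (a * b) → Vec (Fin b) (length Ps)
labels []             x = []
labels ((f , _) ∷ Ps) x = f x ∷ labels Ps x

lookup-labels : ∀ {a b} (Ps : List (Partition a b)) x j → lookup (labels Ps x) j ≡ proj₁ (List.lookup Ps j) x
lookup-labels (P ∷ Ps) x zero    = refl
lookup-labels (P ∷ Ps) x (suc j) = lookup-labels Ps x j

All-relabelling : ∀ {a b} {σ : Permutation′ (a * b)} (φ : Fin b → Fin b) → (∀ {c d} → φ c ≡ φ d → c ≡ d) →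
                  (Ps : List (Partition a b)) → (∀ z → labels Ps (σ ⟨$⟩ʳ z) ≡ Vec.map φ (labels Ps z)) → All σ Ps
All-relabelling φ φ-injective []             _   = []
All-relabelling {σ = σ} φ φ-injective ((f , f-equi) ∷ Ps) σ-acts =
  fixes ∷ All-relabelling φ φ-injective Ps (proj₂ ∘ ∷-injective ∘ σ-acts)
  where
  head-acts : ∀ z → f (σ ⟨$⟩ʳ z) ≡ φ (f z)
  head-acts = ∷-injectiveˡ ∘ σ-acts
  fixes : Fixes σ (f , f-equi)
  fixes x y = mk⇔ (λ fx≡fy → trans (head-acts x) (trans (cong φ fx≡fy) (sym (head-acts y))))
                  (λ fσx≡fσy → φ-injective (trans (sym (head-acts x)) (trans fσx≡fσy (head-acts y))))

All-tabulate : ∀ {a b n} {σ : Permutation′ (a * b)} (P : Fin n → Partition a b) →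
               All σ (List.tabulate P) → ∀ j → Fixes σ (P j)
All-tabulate P (P₀-fixed ∷ _)  zero    = P₀-fixed
All-tabulate P (_ ∷ Pₛ-fixed)  (suc j) = All-tabulate (P ∘ suc) Pₛ-fixed j

labels-injective : ∀ {a b} {Ps : List (Partition a b)} → IsBase a b Ps →
                   ∀ {x y} → labels Ps x ≡ labels Ps y → x ≡ y
labels-injective {Ps = Ps} base {x} {y} same-labels = begin
  x                             ≡⟨ base (transpose x y) transpose-fixes x ⟨
  PC.transpose x y x            ≡⟨ transpose-left x y ⟩
  y                             ∎
  where
  open ≡-Reasoning
  transpose-fixes : All (transpose x y) Ps
  transpose-fixes = All-relabelling id id Ps
    (λ z → trans (transpose-respects (labels Ps) same-labels z) (sym (map-id (labels Ps z))))

multiplicity : ∀ {n k} → (Fin n → Bits k) → Bits k → ℕ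
multiplicity {n} ℓ v = ∑[ x < n ] 𝟙 (ℓ x ≟ᵇ v)

∑Bits-multiplicity : ∀ {n k} (ℓ : Fin n → Bits k) (c : Bits k → ℕ) →
                     ∑Bits k (λ v → c v * multiplicity ℓ v) ≡ ∑[ x < n ] c (ℓ x)
∑Bits-multiplicity {zero}  {k} ℓ c = ∑Bits-zero k _ (λ v → *-zeroʳ (c v))
∑Bits-multiplicity {suc n} {k} ℓ c = begin
  ∑Bits k (λ v → c v * (𝟙 (ℓ zero ≟ᵇ v) + multiplicity (ℓ ∘ suc) v))
    ≡⟨ ∑Bits-cong k (λ v → *-distribˡ-+ (c v) _ _) ⟩
  ∑Bits k (λ v → c v * 𝟙 (ℓ zero ≟ᵇ v) + c v * multiplicity (ℓ ∘ suc) v)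
    ≡⟨ ∑Bits-distrib-+ k (λ v → c v * 𝟙 (ℓ zero ≟ᵇ v)) _ ⟩
  ∑Bits k (λ v → c v * 𝟙 (ℓ zero ≟ᵇ v)) + ∑Bits k (λ v → c v * multiplicity (ℓ ∘ suc) v)
    ≡⟨ cong₂ _+_ (∑Bits-only k _ (ℓ zero) point) (∑Bits-multiplicity (ℓ ∘ suc) c) ⟩
  c (ℓ zero) * 𝟙 (ℓ zero ≟ᵇ ℓ zero) + ∑[ x < n ] c (ℓ (suc x))
    ≡⟨ cong (_+ ∑[ x < n ] c (ℓ (suc x)))
            (trans (cong (c (ℓ zero) *_) (𝟙-yes (ℓ zero ≟ᵇ ℓ zero) refl)) (*-identityʳ _)) ⟩
  c (ℓ zero) + ∑[ x < n ] c (ℓ (suc x)) ∎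
  where
  open ≡-Reasoning
  point : ∀ v → v ≢ ℓ zero → c v * 𝟙 (ℓ zero ≟ᵇ v) ≡ 0
  point v v≢ℓ₀ = trans (cong (c v *_) (𝟙-no (ℓ zero ≟ᵇ v) (v≢ℓ₀ ∘ sym))) (*-zeroʳ (c v))

multiplicity-outside : ∀ {n k} (ℓ : Fin n → Bits k) {v} → (∀ x → ℓ x ≢ v) → multiplicity ℓ v ≡ 0
multiplicity-outside ℓ {v} v∉ℓ = sum-zero _ λ x → 𝟙-no (ℓ x ≟ᵇ v) (v∉ℓ x)

0<multiplicity⇒∃ : ∀ {n k} (ℓ : Fin n → Bits k) {v} → 0 < multiplicity ℓ v → ∃ λ x → ℓ x ≡ v
0<multiplicity⇒∃ ℓ {v} 0<mult with Finₚ.any? (λ x → ℓ x ≟ᵇ v)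
... | yes v∈ℓ = v∈ℓ
... | no  v∉ℓ = contradiction (multiplicity-outside ℓ (λ x → v∉ℓ ∘ (x ,_))) (≢-sym (<⇒≢ 0<mult))

module _ {n k} {ℓ : Fin n → Bits k} (ℓ-injective : ∀ {x y} → ℓ x ≡ ℓ y → x ≡ y) where

  multiplicity-image : ∀ x → multiplicity ℓ (ℓ x) ≡ 1
  multiplicity-image x = trans (sum-only _ x λ y y≢x → 𝟙-no (ℓ y ≟ᵇ ℓ x) (y≢x ∘ ℓ-injective))
                               (𝟙-yes (ℓ x ≟ᵇ ℓ x) refl)

  multiplicity-≤1 : ∀ v → multiplicity ℓ v ≤ 1
  multiplicity-≤1 v with Finₚ.any? (λ x → ℓ x ≟ᵇ v)
  ... | yes (x , refl) = ≤-reflexive (multiplicity-image x)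
  ... | no  v∉ℓ        = ≤-trans (≤-reflexive (multiplicity-outside ℓ (λ x → v∉ℓ ∘ (x ,_)))) z≤n

  injective⇒≤2^ : n ≤ 2 ^ k
  injective⇒≤2^ = begin
    n                                          ≡⟨ sum-ones n ⟨
    ∑[ x < n ] 1                               ≡⟨ ∑Bits-multiplicity ℓ (λ _ → 1) ⟨
    ∑Bits k (λ v → 1 * multiplicity ℓ v)       ≤⟨ ∑Bits-mono k (λ v → subst (_≤ 1) (sym (*-identityˡ _)) (multiplicity-≤1 v)) ⟩
    ∑Bits k (λ _ → 1)                          ≡⟨ ∑Bits-ones k ⟩
    2 ^ k                                      ∎
    where open ≤-Reasoning

equipartition-count : ∀ {a b} (P : Partition a b) β → ∑[ x < a * b ] 𝟙 (proj₁ P x ≟ β) ≡ a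
equipartition-count {a} {b} (f , f-equi) β =
  trans (sym (length-filter-tabulate (λ x → f x ≟ β) id)) (f-equi β)

labels-halfSum : ∀ {a} (Ps : List (Partition a 2)) j β → halfSum j β (multiplicity (labels Ps)) ≡ a
labels-halfSum {a} Ps j β = begin
  halfSum j β (multiplicity (labels Ps))               ≡⟨ ∑Bits-multiplicity (labels Ps) (λ v → 𝟙 (lookup v j ≟ β)) ⟩
  ∑[ x < a * 2 ] 𝟙 (lookup (labels Ps x) j ≟ β)        ≡⟨ sum-cong-≗ (λ x → cong (λ c → 𝟙 (c ≟ β)) (lookup-labels Ps x j)) ⟩
  ∑[ x < a * 2 ] 𝟙 (proj₁ (List.lookup Ps j) x ≟ β)    ≡⟨ equipartition-count (List.lookup Ps j) β ⟩
  a                                                    ∎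
  where open ≡-Reasoning

no-base-of-length : ∀ {k a} → 1 ≤ a → a ≡ 2 ^ k ⊎ suc a ≡ 2 ^ k →
                    (Ps : List (Partition a 2)) → IsBase a 2 Ps → length Ps ≢ suc k
no-base-of-length {a = suc a} _ a-cases (P ∷ Ps) base refl =
  b≢not-b _ (∷-injectiveˡ (trans (sym (cong ℓ (base σ σ-fixes zero))) (proj₂ (partner zero))))
  where
  ℓ = labels (P ∷ Ps)
  ℓ-injective = labels-injective base
  partner : ∀ x → ∃ λ y → ℓ y ≡ complement (ℓ x)
  partner x = 0<multiplicity⇒∃ ℓ (≤-reflexive (sym
    (complement-closed (multiplicity ℓ) (multiplicity-≤1 ℓ-injective) (labels-halfSum (P ∷ Ps)) a-cases {ℓ x}
                       (multiplicity-image ℓ-injective x))))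
  partner-involutive : ∀ x → proj₁ (partner (proj₁ (partner x))) ≡ x
  partner-involutive x = ℓ-injective (begin
    ℓ (proj₁ (partner (proj₁ (partner x))))   ≡⟨ proj₂ (partner _) ⟩
    complement (ℓ (proj₁ (partner x)))        ≡⟨ cong complement (proj₂ (partner x)) ⟩
    complement (complement (ℓ x))             ≡⟨ complement-involutive (ℓ x) ⟩
    ℓ x                                       ∎)
    where open ≡-Reasoning
  σ : Permutation′ (suc a * 2)
  σ = permutation (proj₁ ∘ partner) (proj₁ ∘ partner) partner-involutive partner-involutive
  σ-fixes : All σ (P ∷ Ps)
  σ-fixes = All-relabelling not not-injective (P ∷ Ps) (proj₂ ∘ partner)

base-length-lower-bound : ∀ {i a} → 2 ≤ i → a ≡ 2 ^ i ⊎ suc a ≡ 2 ^ i →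
                          (Ps : List (Partition a 2)) → IsBase a 2 Ps → i + 2 ≤ length Ps
base-length-lower-bound {i} {a} 2≤i a-cases Ps base =
  subst (_≤ length Ps) (+-comm 2 i) (≤∧≢⇒< i<L (no-base-of-length 1≤a a-cases Ps base ∘ sym))
  where
  4≤2ⁱ : 4 ≤ 2 ^ i
  4≤2ⁱ = ^-monoʳ-≤ 2 2≤i
  2ⁱ≤1+a : 2 ^ i ≤ suc a
  2ⁱ≤1+a = [ (λ a≡2ⁱ → ≤-trans (≤-reflexive (sym a≡2ⁱ)) (n≤1+n a)) , ≤-reflexive ∘ sym ]′ a-cases
  1≤a : 1 ≤ a
  1≤a = ≤-pred (≤-trans (≤-trans (s≤s (s≤s z≤n)) 4≤2ⁱ) 2ⁱ≤1+a)
  i<L : i < length Ps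
  i<L with i <? length Ps
  ... | yes i<L = i<L
  ... | no  i≮L = contradiction (≤-trans 4≤2ⁱ (≤-trans 2ⁱ≤1+a (s≤s a≤1))) λ where (s≤s (s≤s ()))
    where
    a≤1 : a ≤ 1
    a≤1 = +-cancelˡ-≤ a a 1 (begin
      a + a          ≡⟨ cong (a +_) (+-identityʳ a) ⟨
      2 * a          ≡⟨ *-comm 2 a ⟩
      a * 2          ≤⟨ injective⇒≤2^ (labels-injective base) ⟩
      2 ^ length Ps  ≤⟨ ^-monoʳ-≤ 2 (≮⇒≥ i≮L) ⟩
      2 ^ i          ≤⟨ 2ⁱ≤1+a ⟩
      suc a          ≡⟨ +-comm 1 a ⟩
      a + 1          ∎)
      where open ≤-Reasoning

-- The construction

RowLabelling : ℕ → Set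
RowLabelling a = Fin a → Fin 2 → Fin 2

sum-rows : ∀ a (h : Fin (a * 2) → ℕ) → ∑[ x < a * 2 ] h x ≡ ∑[ q < a ] (h (combine q 0F) + h (combine q 1F))
sum-rows zero    h = refl
sum-rows (suc a) h = trans (sym (+-assoc (h 0F) (h 1F) (∑[ x < a * 2 ] h (suc (suc x)))))
                           (cong (h 0F + h 1F +_) (sum-rows a (λ x → h (suc (suc x)))))

module _ {a : ℕ} where

  row : Fin (a * 2) → Fin a
  row = quotient {a} 2

  column : Fin (a * 2) → Fin 2
  column = remainder {a} 2

  row-combine : ∀ (q : Fin a) b → row (combine q b) ≡ q
  row-combine q b = cong proj₁ (Finₚ.remQuot-combine q b)

  column-combine : ∀ (q : Fin a) b → column (combine q b) ≡ b
  column-combine q b = cong proj₂ (Finₚ.remQuot-combine q b)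

  combine-row-column : ∀ (x : Fin (a * 2)) → combine (row x) (column x) ≡ x
  combine-row-column = Finₚ.combine-remQuot {a} 2

  byRows : RowLabelling a → Labelling a 2
  byRows L x = L (row x) (column x)

  Balanced : RowLabelling a → Set
  Balanced L = ∀ β → ∑[ q < a ] (𝟙 (L q 0F ≟ β) + 𝟙 (L q 1F ≟ β)) ≡ a

  rowPartition : ∀ (L : RowLabelling a) → Balanced L → Partition a 2
  rowPartition L L-balanced = byRows L , λ β → begin
    length (filter (λ x → byRows L x ≟ β) (List.allFin (a * 2)))
      ≡⟨ length-filter-tabulate (λ x → byRows L x ≟ β) id ⟩
    ∑[ x < a * 2 ] 𝟙 (byRows L x ≟ β)
      ≡⟨ sum-rows a _ ⟩
    ∑[ q < a ] (𝟙 (byRows L (combine q 0F) ≟ β) + 𝟙 (byRows L (combine q 1F) ≟ β))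
      ≡⟨ sum-cong-≗ (λ q → cong₂ _+_ (cong (λ c → 𝟙 (c ≟ β)) (byRows-combine q 0F))
                                     (cong (λ c → 𝟙 (c ≟ β)) (byRows-combine q 1F))) ⟩
    ∑[ q < a ] (𝟙 (L q 0F ≟ β) + 𝟙 (L q 1F ≟ β))
      ≡⟨ L-balanced β ⟩
    a ∎
    where
    open ≡-Reasoning
    byRows-combine : ∀ q b → byRows L (combine q b) ≡ L q b
    byRows-combine q b = cong₂ L (row-combine q b) (column-combine q b)

  distinct-rows⇒Balanced : ∀ (L : RowLabelling a) → (∀ q → L q 0F ≢ L q 1F) → Balanced L
  distinct-rows⇒Balanced L distinct β = trans (sum-cong-≗ row-count) (sum-ones a)
    where
    row-count : ∀ q → 𝟙 (L q 0F ≟ β) + 𝟙 (L q 1F ≟ β) ≡ 1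
    row-count q = trans (cong (λ c → 𝟙 (L q 0F ≟ β) + 𝟙 (c ≟ β)) (≢⇒≡not (distinct q)))
                        (𝟙-complementary (L q 0F) β)

  -- Rows with equal addresses are separated by their colours; the monochrome
  -- row rules out exchanging the two colours and then the bichrome row rules
  -- out exchanging the two columns.
  record Design (n : ℕ) : Set where
    field
      address           : Fin a → Bits n
      hole              : Bits n
      colour            : RowLabelling a
      colour-balanced   : Balanced colour
      hole-unaddressed  : ∀ q → address q ≢ hole
      addresses-cover   : ∀ w → w ≢ hole → ∃ λ q → address q ≡ w
      separating        : ∀ {q q′} b → address q′ ≡ address q → colour q′ b ≡ colour q b → q′ ≡ q
      monochrome        : Fin a
      monochrome-colour : colour monochrome 0F ≡ colour monochrome 1F
      monochrome-alone  : ∀ {q} → address q ≡ address monochrome → q ≡ monochrome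
      bichrome          : Fin a
      bichrome-colour   : colour bichrome 0F ≢ colour bichrome 1F
      bichrome-alone    : ∀ {q} → address q ≡ address bichrome → q ≡ bichrome

  module _ {n} (D : Design n) where
    open Design D

    columnPartition : Partition a 2
    columnPartition = rowPartition (λ q b → b) (distinct-rows⇒Balanced (λ q b → b) λ _ ())

    colourPartition : Partition a 2
    colourPartition = rowPartition colour colour-balanced

    addressLabelling : Fin n → RowLabelling a
    addressLabelling j q b = lookup (address q) j ⊕ b

    addressPartition : Fin n → Partition a 2
    addressPartition j = rowPartition (addressLabelling j)
      (distinct-rows⇒Balanced (addressLabelling j) λ q → ⊕-distinct (lookup (address q) j))

    designPartitions : List (Partition a 2)
    designPartitions = columnPartition ∷ colourPartition ∷ List.tabulate addressPartition

    designPartitions-length : length designPartitions ≡ n + 2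
    designPartitions-length = trans (cong (2 +_) (length-tabulate addressPartition)) (+-comm 2 n)

    module _ (σ : Permutation′ (a * 2)) (column-fixed : Fixes σ columnPartition)
             (colour-fixed : Fixes σ colourPartition) (address-fixed : ∀ j → Fixes σ (addressPartition j)) where

      private
        s : Fin (a * 2) → Fin (a * 2)
        s = σ ⟨$⟩ʳ_
        p₀ : Fin (a * 2)
        p₀ = combine monochrome 0F
        shift : RowLabelling a → Fin 2
        shift L = byRows L p₀ ⊕ byRows L (s p₀)
        β γ : Fin 2
        β = shift (λ q b → b)
        γ = shift colour
        δ : Fin n → Fin 2
        δ j = shift (addressLabelling j) ⊕ β
        bit : Fin (a * 2) → Fin n → Fin 2
        bit x j = lookup (address (row x)) j

      column-shift : ∀ x → column x ⊕ column (s x) ≡ β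
      column-shift x = ≡⇔≡⇒⊕≡⊕ (column-fixed x p₀)

      colour-shift : ∀ x → byRows colour x ⊕ byRows colour (s x) ≡ γ
      colour-shift x = ≡⇔≡⇒⊕≡⊕ (colour-fixed x p₀)

      address-shift : ∀ x j → bit x j ⊕ bit (s x) j ≡ δ j
      address-shift x j = ⊕-moveʳ (begin
        (bit x j ⊕ bit (s x) j) ⊕ β                       ≡⟨ cong ((bit x j ⊕ bit (s x) j) ⊕_) (column-shift x) ⟨
        (bit x j ⊕ bit (s x) j) ⊕ (column x ⊕ column (s x)) ≡⟨ ⊕-interchange (bit x j) (column x) (bit (s x) j) (column (s x)) ⟨
        (bit x j ⊕ column x) ⊕ (bit (s x) j ⊕ column (s x)) ≡⟨ ≡⇔≡⇒⊕≡⊕ (address-fixed j x p₀) ⟩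
        shift (addressLabelling j)                         ∎)
        where open ≡-Reasoning

      private
        translatedHole : Bits n
        translatedHole = Vec.tabulate (λ j → δ j ⊕ lookup hole j)

      translatedHole≡hole : translatedHole ≡ hole
      translatedHole≡hole with translatedHole ≟ᵇ hole
      ... | yes ≡hole = ≡hole
      ... | no  ≢hole = contradiction (lookup-extensionality moved-to-hole) (hole-unaddressed (row (s x)))
        where
        q = proj₁ (addresses-cover translatedHole ≢hole)
        x = combine q 0F
        bit-x : ∀ j → bit x j ≡ δ j ⊕ lookup hole j
        bit-x j = begin
          lookup (address (row x)) j   ≡⟨ cong (λ q → lookup (address q) j) (row-combine q 0F) ⟩
          lookup (address q) j         ≡⟨ cong (λ w → lookup w j) (proj₂ (addresses-cover translatedHole ≢hole)) ⟩
          lookup translatedHole j      ≡⟨ lookup∘tabulate _ j ⟩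
          δ j ⊕ lookup hole j          ∎
          where open ≡-Reasoning
        moved-to-hole : ∀ j → bit (s x) j ≡ lookup hole j
        moved-to-hole j = ⊕-cancelˡ (trans (cong (_⊕ bit (s x) j) (sym (bit-x j))) (address-shift x j))

      δ-trivial : ∀ j → δ j ≡ 0F
      δ-trivial j = b⊕c≡c⇒b≡0 (trans (sym (lookup∘tabulate _ j)) (cong (λ w → lookup w j) translatedHole≡hole))

      address-preserved : ∀ x → address (row (s x)) ≡ address (row x)
      address-preserved x = sym (lookup-extensionality λ j → ⊕≡0⇒≡ (trans (address-shift x j) (δ-trivial j)))

      colour-shift-alone : ∀ {q} → (∀ {q′} → address q′ ≡ address q → q′ ≡ q) →
                           ∀ b → colour q b ⊕ colour q (b ⊕ β) ≡ γ
      colour-shift-alone {q} alone b = begin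
        colour q b ⊕ colour q (b ⊕ β)                  ≡⟨ cong₂ _⊕_ (cong₂ colour (row-combine q b) (column-combine q b))
                                                                     (cong₂ colour row-fixed column-moved) ⟨
        byRows colour x ⊕ byRows colour (s x)          ≡⟨ colour-shift x ⟩
        γ                                              ∎
        where
        open ≡-Reasoning
        x = combine q b
        row-fixed : row (s x) ≡ q
        row-fixed = alone (trans (address-preserved x) (cong address (row-combine q b)))
        column-moved : column (s x) ≡ b ⊕ β
        column-moved = ⊕-moveˡ {b} (trans (cong (_⊕ column (s x)) (sym (column-combine q b))) (column-shift x))

      γ-trivial : γ ≡ 0F
      γ-trivial = begin
        γ                                                    ≡⟨ colour-shift-alone monochrome-alone 0F ⟨
        colour monochrome 0F ⊕ colour monochrome β           ≡⟨ cong (colour monochrome 0F ⊕_) (monochrome-constant β) ⟩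
        colour monochrome 0F ⊕ colour monochrome 0F          ≡⟨ ⊕-self (colour monochrome 0F) ⟩
        0F                                                   ∎
        where
        open ≡-Reasoning
        monochrome-constant : ∀ b → colour monochrome b ≡ colour monochrome 0F
        monochrome-constant 0F = refl
        monochrome-constant 1F = sym monochrome-colour

      β-trivial : β ≡ 0F
      β-trivial = bichrome-changes (⊕≡0⇒≡ (trans (colour-shift-alone bichrome-alone 0F) γ-trivial))
        where
        bichrome-changes : ∀ {b} → colour bichrome 0F ≡ colour bichrome b → b ≡ 0F
        bichrome-changes {0F} _    = refl
        bichrome-changes {1F} same = contradiction same bichrome-colour

      stabiliser-trivial : ∀ x → s x ≡ x
      stabiliser-trivial x = begin
        s x                                  ≡⟨ combine-row-column (s x) ⟨
        combine (row (s x)) (column (s x))   ≡⟨ cong₂ combine row-kept column-kept ⟩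
        combine (row x) (column x)           ≡⟨ combine-row-column x ⟩
        x                                    ∎
        where
        open ≡-Reasoning
        column-kept : column (s x) ≡ column x
        column-kept = sym (⊕≡0⇒≡ (trans (column-shift x) β-trivial))
        colour-kept : colour (row (s x)) (column x) ≡ colour (row x) (column x)
        colour-kept = trans (cong (colour (row (s x))) (sym column-kept)) (sym (⊕≡0⇒≡ (trans (colour-shift x) γ-trivial)))
        row-kept : row (s x) ≡ row x
        row-kept = separating (column x) (address-preserved x) colour-kept

    designPartitions-base : IsBase a 2 designPartitions
    designPartitions-base σ (column-fixed ∷ colour-fixed ∷ addresses-fixed) =
      stabiliser-trivial σ column-fixed colour-fixed (All-tabulate addressPartition addresses-fixed)

funToFin-cong : ∀ {m n} {f g : Fin m → Fin n} → (∀ i → f i ≡ g i) → funToFin f ≡ funToFin g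
funToFin-cong {zero}  _   = refl
funToFin-cong {suc m} f≗g = cong₂ combine (f≗g zero) (funToFin-cong (f≗g ∘ suc))

Fin2^↔Bits : ∀ n → Fin (2 ^ n) ↔ Bits n
Fin2^↔Bits n = mk↔ₛ′ (Vec.tabulate ∘ finToFun) (funToFin ∘ lookup)
  (λ w → trans (tabulate-cong (Finₚ.finToFun-funToFin (lookup w))) (tabulate∘lookup w))
  (λ c → trans (funToFin-cong {n} (lookup∘tabulate (finToFun c))) (Finₚ.funToFin-finToFin {n} c))

puncturedDesign : ∀ {n a} → 3 ≤ a → Fin (suc a) ↔ Bits n → Design {a} n
puncturedDesign {n} (s≤s (s≤s (s≤s {n = r} z≤n))) code = record
  { address           = address
  ; hole              = to 0F
  ; colour            = colour
  ; colour-balanced   = λ { 0F → cong (3 +_) (sum-ones r) ; 1F → cong (3 +_) (sum-ones r) }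
  ; hole-unaddressed  = λ q → (λ ()) ∘ injective
  ; addresses-cover   = cover
  ; separating        = λ _ same-address _ → address-injective same-address
  ; monochrome        = 0F
  ; monochrome-colour = refl
  ; monochrome-alone  = address-injective
  ; bichrome          = 2F
  ; bichrome-colour   = λ ()
  ; bichrome-alone    = address-injective
  }
  where
  open Inverse code using (to; from; strictlyInverseˡ)
  open Injection (↔⇒↣ code) using (injective)
  address : Fin (3 + r) → Bits n
  address q = to (suc q)
  address-injective : ∀ {q q′} → address q ≡ address q′ → q ≡ q′
  address-injective = Finₚ.suc-injective ∘ injective
  colour : RowLabelling (3 + r)
  colour 0F            _ = 0F
  colour 1F            _ = 1F
  colour (suc (suc _)) b = b
  cover : ∀ w → w ≢ to 0F → ∃ λ q → address q ≡ w
  cover w w≢hole with from w in from-w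
  ... | 0F    = contradiction (trans (sym (strictlyInverseˡ w)) (cong to from-w)) w≢hole
  ... | suc q = q , trans (cong to (sym from-w)) (strictlyInverseˡ w)

-- Rows 0 and 1 share an address and are separated by their colours.
fullDesign : ∀ {n a} → 5 ≤ a → Fin a ↔ Bits n → Design {a} n
fullDesign {n} (s≤s (s≤s (s≤s (s≤s (s≤s {n = r} z≤n))))) code = record
  { address           = address
  ; hole              = to 1F
  ; colour            = colour
  ; colour-balanced   = λ { 0F → cong (5 +_) (sum-ones r) ; 1F → cong (5 +_) (sum-ones r) }
  ; hole-unaddressed  = λ q → merge≢1 q ∘ injective
  ; addresses-cover   = cover
  ; separating        = λ b → merge-separated b ∘ injective
  ; monochrome        = 2F
  ; monochrome-colour = refl
  ; monochrome-alone  = merge≡2+ ∘ injective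
  ; bichrome          = 4F
  ; bichrome-colour   = λ ()
  ; bichrome-alone    = merge≡2+ ∘ injective
  }
  where
  open Inverse code using (to; from; strictlyInverseˡ)
  open Injection (↔⇒↣ code) using (injective)
  merge : Fin (5 + r) → Fin (5 + r)
  merge 1F = 0F
  merge q  = q
  address : Fin (5 + r) → Bits n
  address = to ∘ merge
  colour : RowLabelling (5 + r)
  colour 0F                         b = b
  colour 1F                         b = not b
  colour 2F                         _ = 0F
  colour 3F                         _ = 1F
  colour (suc (suc (suc (suc _)))) b = b
  merge≢1 : ∀ q → merge q ≢ 1F
  merge≢1 0F ()
  merge≢1 1F ()
  merge≢1 (suc (suc _)) ()
  merge≡2+ : ∀ {q p} → merge q ≡ suc (suc p) → q ≡ suc (suc p)
  merge≡2+ {suc (suc _)} eq = eq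
  merge-separated : ∀ {q q′} b → merge q′ ≡ merge q → colour q′ b ≡ colour q b → q′ ≡ q
  merge-separated {0F}          {0F}          _ _          _    = refl
  merge-separated {1F}          {1F}          _ _          _    = refl
  merge-separated {0F}          {1F}          b _          same = contradiction (sym same) (b≢not-b b)
  merge-separated {1F}          {0F}          b _          same = contradiction same (b≢not-b b)
  merge-separated {suc (suc _)} {suc (suc _)} _ same-merge _    = same-merge
  cover : ∀ w → w ≢ to 1F → ∃ λ q → address q ≡ w
  cover w w≢hole = from w , trans (cong to merge-from) (strictlyInverseˡ w)
    where
    merge-from : merge (from w) ≡ from w
    merge-from with from w in from-w
    ... | 0F           = refl
    ... | 1F           = contradiction (trans (sym (strictlyInverseˡ w)) (cong to from-w)) w≢hole
    ... | suc (suc _)  = refl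

design⇒BaseSizeIs : ∀ {i a} → 2 ≤ i → a ≡ 2 ^ i ⊎ suc a ≡ 2 ^ i → Design {a} i → BaseSizeIs a 2 (i + 2)
design⇒BaseSizeIs 2≤i a-cases D =
  (designPartitions D , designPartitions-base D , designPartitions-length D) , base-length-lower-bound 2≤i a-cases

lemma6p1 : (i : ℕ) → 3 ≤ i → (a : ℕ) → (a ≡ 2 ^ i ⊎ a ≡ 2 ^ i ∸ 1) →
           BaseSizeIs a 2 (i + 2)
lemma6p1 i 3≤i a a≡2ⁱ-or-pred = design⇒BaseSizeIs (≤-trans (n≤1+n 2) 3≤i) a-cases (design a-cases)
  where
  8≤2ⁱ : 8 ≤ 2 ^ i
  8≤2ⁱ = ^-monoʳ-≤ 2 3≤i
  a-cases : a ≡ 2 ^ i ⊎ suc a ≡ 2 ^ i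
  a-cases = map₂ (λ a≡2ⁱ∸1 → trans (cong suc a≡2ⁱ∸1) (m+[n∸m]≡n (≤-trans (s≤s z≤n) 8≤2ⁱ))) a≡2ⁱ-or-pred
  design : ∀ {a} → a ≡ 2 ^ i ⊎ suc a ≡ 2 ^ i → Design {a} i
  design (inj₁ refl)     = fullDesign (≤-trans (m≤m+n 5 3) 8≤2ⁱ) (Fin2^↔Bits i)
  design (inj₂ 1+a≡2ⁱ) = puncturedDesign (≤-trans (m≤m+n 3 4) (≤-pred (subst (8 ≤_) (sym 1+a≡2ⁱ) 8≤2ⁱ)))
                                         (subst (λ m → Fin m ↔ Bits i) (sym 1+a≡2ⁱ) (Fin2^↔Bits i))
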